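{- Let $S$ be an opetopic cardinal. Then its associated positive-to-one poset satisfies oriented thinness: whenever $z\prec^{\beta}y\prec^{\alpha}x$, there is a unique $y'\neq y$ with $z\prec y'\prec x$, and writing $z\prec^{\beta'}y'\prec^{\alpha'}x$, the signs (read as $\pm1$) satisfy $\alpha\beta=-\alpha'\beta'$.
   Context: A positive hypergraph $S$ consists of finite sets $S_k$ ($k\in\mathbb{N}$), all but finitely many empty, and maps $\gamma:S_{k+1}\to S_k$, $\delta:S_{k+1}\to\mathcal{P}(S_k)$ with $\delta(a)\neq\emptyset$ for all $a$ and $\delta(a)$ a singleton for $a\in S_1$. For $a\in S_{k+2}$: $\gamma\gamma(a)=\{\gamma(\gamma(a))\}$, $\gamma\delta(a)=\{\gamma(x):x\in\delta(a)\}$, $\delta\gamma(a)=\delta(\gamma(a))$, $\delta\delta(a)=\bigcup_{x\in\delta(a)}\delta(x)$. For $a,b\in S_k$: $a\triangleleft^+b$ iff there is $\alpha\in S_{k+1}$ with $a\in\delta(\alpha)$, $\gamma(\alpha)=b$, and $<^+$ is its transitive closure; for $k\ge1$, $a\triangleleft^-b$ iff $\gamma(a)\in\delta(b)$, and $<^-$ is its transitive closure. An opetopic cardinal is a positive hypergraph satisfying: globularity (for $a\in S_{\ge2}$, $\gamma\gamma(a)=\gamma\delta(a)\setminus\delta\delta(a)$ and $\delta\gamma(a)=\delta\delta(a)\setminus\gamma\delta(a)$); strictness (each $<^+$ on $S_k$ is a strict partial order, and $<^+$ on $S_0$ is total); disjointness (for $k>0$, no $a,b\in S_k$ are comparable both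 for $<^+$ and for $<^-$); pencil linearity (for $k>0$, $x\in S_{k-1}$, the sets $\{a\in S_k:x\in\delta(a)\}$ and $\{a\in S_k:\gamma(a)=x\}$ are linearly ordered by $<^+$). The associated positive-to-one poset has elements $\bigsqcup_kS_k$, $\dim x=k$ for $x\in S_k$, $y\prec^-x$ iff $y\in\delta(x)$, $y\prec^+x$ iff $y=\gamma(x)$, and $y\prec x$ iff $y\prec^-x$ or $y\prec^+x$. -}

module Defs where

open import Data.Nat using (ℕ; zero; suc; _≤_)
open import Data.Fin using (Fin)
open import Data.Fin.Subset using (Subset; _∈_; Nonempty)
open import Data.Product using (Σ; ∃; _×_; _,_)
open import Data.Sum using (_⊎_)
open import Data.Empty using (⊥)
open import Relation.Nullary using (¬_)
open import Relation.Binary.PropositionalEquality using (_≡_; _≢_)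
open import Relation.Binary.Construct.Closure.Transitive using (TransClosure)

_⟺_ : Set → Set → Set
A ⟺ B = (A → B) × (B → A)

-- A positive hypergraph.  S_k is represented by Fin (card k).
-- The sets S_k are finite and all but finitely many are empty.
record PosHypergraph : Set where
  field
    card     : ℕ → ℕ
    bound    : ℕ
    finitely : ∀ k → bound ≤ k → card k ≡ 0
    γ        : ∀ {k} → Fin (card (suc k)) → Fin (card k)
    δ        : ∀ {k} → Fin (card (suc k)) → Subset (card k)
    δ-nonempty : ∀ {k} (a : Fin (card (suc k))) → Nonempty (δ a)
    δ-singleton₁ : ∀ (a : Fin (card 1)) → ∃ λ x → ∀ y → (y ∈ δ a) ⟺ (y ≡ x)

  _◁⁺_ : ∀ {k} → Fin (card k) → Fin (card k) → Set
  _◁⁺_ {k} a b = Σ (Fin (card (suc k))) λ α → (a ∈ δ α) × (γ α ≡ b)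

  _<⁺_ : ∀ {k} → Fin (card k) → Fin (card k) → Set
  _<⁺_ = TransClosure _◁⁺_

  _◁⁻_ : ∀ {j} → Fin (card (suc j)) → Fin (card (suc j)) → Set
  a ◁⁻ b = γ a ∈ δ b

  _<⁻_ : ∀ {j} → Fin (card (suc j)) → Fin (card (suc j)) → Set
  _<⁻_ = TransClosure _◁⁻_

  _∈γγ_ : ∀ {k} → Fin (card k) → Fin (card (suc (suc k))) → Set
  y ∈γγ a = y ≡ γ (γ a)
  _∈γδ_ : ∀ {k} → Fin (card k) → Fin (card (suc (suc k))) → Set
  y ∈γδ a = Σ (Fin _) λ x → (x ∈ δ a) × (γ x ≡ y)
  _∈δγ_ : ∀ {k} → Fin (card k) → Fin (card (suc (suc k))) → Set
  y ∈δγ a = y ∈ δ (γ a)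
  _∈δδ_ : ∀ {k} → Fin (card k) → Fin (card (suc (suc k))) → Set
  y ∈δδ a = Σ (Fin _) λ x → (x ∈ δ a) × (y ∈ δ x)

Comparable : {A : Set} → (A → A → Set) → A → A → Set
Comparable R a b = R a b ⊎ R b a

LinOrd : {A : Set} → (A → Set) → (A → A → Set) → Set
LinOrd {A} P R = ∀ (a b : A) → P a → P b → (a ≡ b) ⊎ Comparable R a b

record IsOpetopicCardinal (S : PosHypergraph) : Set where
  open PosHypergraph S
  field
    glob-γ : ∀ {k} (a : Fin (card (suc (suc k)))) (y : Fin (card k)) →
             (y ∈γγ a) ⟺ ((y ∈γδ a) × ¬ (y ∈δδ a))
    glob-δ : ∀ {k} (a : Fin (card (suc (suc k)))) (y : Fin (card k)) →
             (y ∈δγ a) ⟺ ((y ∈δδ a) × ¬ (y ∈γδ a))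
    strict-irrefl : ∀ {k} (a : Fin (card k)) → ¬ (a <⁺ a)
    strict-total₀ : ∀ (a b : Fin (card 0)) → (a ≡ b) ⊎ Comparable _<⁺_ a b
    disjoint : ∀ {j} (a b : Fin (card (suc j))) →
               ¬ (Comparable _<⁺_ a b × Comparable _<⁻_ a b)
    pencil-δ : ∀ {j} (x : Fin (card j)) →
               LinOrd (λ (a : Fin (card (suc j))) → x ∈ δ a) _<⁺_
    pencil-γ : ∀ {j} (x : Fin (card j)) →
               LinOrd (λ (a : Fin (card (suc j))) → γ a ≡ x) _<⁺_

data Sign : Set where
  ⊕ ⊖ : Sign

_·_ : Sign → Sign → Sign
⊕ · s = s
⊖ · ⊕ = ⊖
⊖ · ⊖ = ⊕

neg : Sign → Sign
neg ⊕ = ⊖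
neg ⊖ = ⊕

module PosetOf (S : PosHypergraph) where
  open PosHypergraph S

  Elem : Set
  Elem = Σ ℕ λ k → Fin (card k)

  dim : Elem → ℕ
  dim (k , _) = k

  data _≺[_]_ : Elem → Sign → Elem → Set where
    ≺⁻ : ∀ {k} {x : Fin (card (suc k))} {y : Fin (card k)} →
         y ∈ δ x → (k , y) ≺[ ⊖ ] (suc k , x)
    ≺⁺ : ∀ {k} {x : Fin (card (suc k))} {y : Fin (card k)} →
         y ≡ γ x → (k , y) ≺[ ⊕ ] (suc k , x)

  _≺_ : Elem → Elem → Set
  y ≺ x = Σ Sign λ s → y ≺[ s ] x

  OrientedThin : Set
  OrientedThin = ∀ (x y z : Elem) (α β : Sign) → z ≺[ β ] y → y ≺[ α ] x →
    Σ Elem λ y' → (y' ≢ y) × (z ≺ y') × (y' ≺ x)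
      × (∀ y'' → y'' ≢ y → z ≺ y'' → y'' ≺ x → y'' ≡ y')
      × (∀ α' β' → z ≺[ β' ] y' → y' ≺[ α' ] x → (α · β) ≡ neg (α' · β'))

{-# OPTIONS --safe #-}
-- Call z ≺^β y ≺^α x (x ∈ S_{k+2}, z ∈ S_k) a route of sign αβ through y.
-- Globularity turns every route into one of the opposite sign (deciding, when
-- y ∈ δx, whether z lies in δδx resp. γδx).  Conversely the sign determines
-- the middle: globularity separates the routes through γx from those through
-- δx, and δx is a <⁺-antichain (from a <⁺ b in δx one gets w <⁻ x with a ∈ δw,
-- and pencil linearity at a then contradicts strictness or disjointness), so
-- pencil linearity at z leaves at most one source of x with target z and at
-- most one with source z.
module Submission where

open import Defs
open import Data.Nat using (suc)
open import Data.Fin using (Fin)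
open import Data.Fin.Subset using (_∈_; _∉_)
open import Data.Fin.Subset.Properties using (_∈?_)
open import Data.Fin.Properties using (any?; _≟_)
open import Data.Product using (Σ; _×_; _,_; proj₁; proj₂)
open import Data.Sum using (_⊎_; inj₁; inj₂)
open import Data.Empty using (⊥-elim)
open import Relation.Nullary using (¬_; Dec; yes; no)
open import Relation.Nullary.Decidable using (_×-dec_)
open import Relation.Binary.PropositionalEquality
  using (_≡_; _≢_; refl; sym; trans; cong; cong₂)
open import Relation.Binary.Construct.Closure.Transitive using ([_]; _∷_)

neg-involutive : ∀ s → neg (neg s) ≡ s
neg-involutive ⊕ = refl
neg-involutive ⊖ = refl

s≢neg[s] : ∀ s → s ≢ neg s
s≢neg[s] ⊕ ()
s≢neg[s] ⊖ ()

≡⊎≡neg : ∀ s t → t ≡ s ⊎ t ≡ neg s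
≡⊎≡neg ⊕ ⊕ = inj₁ refl
≡⊎≡neg ⊕ ⊖ = inj₂ refl
≡⊎≡neg ⊖ ⊕ = inj₂ refl
≡⊎≡neg ⊖ ⊖ = inj₁ refl

module _ (S : PosHypergraph) where
  open PosHypergraph S

  <⁻⇒γ<⁺γ : ∀ {j} {a b : Fin (card (suc j))} → a <⁻ b → γ a <⁺ γ b
  <⁻⇒γ<⁺γ {b = b} [ a◁⁻b ] = [ b , a◁⁻b , refl ]
  <⁻⇒γ<⁺γ (_∷_ {y = c} a◁⁻c c<⁻b) = (c , a◁⁻c , refl) ∷ <⁻⇒γ<⁺γ c<⁻b

  <⁺∘δ⇒δ∘<⁻ : ∀ {k} {x : Fin (card (suc (suc k)))} {a b : Fin (card (suc k))} →
              a <⁺ b → b ∈ δ x → Σ (Fin (card (suc (suc k)))) λ w → a ∈ δ w × w <⁻ x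
  <⁺∘δ⇒δ∘<⁻ [ w , a∈δw , refl ] b∈δx = w , a∈δw , [ b∈δx ]
  <⁺∘δ⇒δ∘<⁻ (_∷_ (w , a∈δw , refl) c<⁺b) b∈δx with <⁺∘δ⇒δ∘<⁻ c<⁺b b∈δx
  ... | w′ , γw∈δw′ , w′<⁻x = w , a∈δw , γw∈δw′ ∷ w′<⁻x

  ∈γδ? : ∀ {k} (x : Fin (card (suc (suc k)))) (z : Fin (card k)) → Dec (z ∈γδ x)
  ∈γδ? x z = any? λ a → (a ∈? δ x) ×-dec (γ a ≟ z)

  ∈δδ? : ∀ {k} (x : Fin (card (suc (suc k)))) (z : Fin (card k)) → Dec (z ∈δδ x)
  ∈δδ? x z = any? λ a → (a ∈? δ x) ×-dec (z ∈? δ a)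

  open PosetOf S

  data Route (z y x : Elem) (s : Sign) : Set where
    route : ∀ {α β} → z ≺[ β ] y → y ≺[ α ] x → α · β ≡ s → Route z y x s

module OpetopicCardinal {S : PosHypergraph} (O : IsOpetopicCardinal S) where
  open PosHypergraph S
  open IsOpetopicCardinal O
  open PosetOf S

  γ∉δ : ∀ {k} (w : Fin (card (suc k))) → γ w ∉ δ w
  γ∉δ w γw∈δw = strict-irrefl (γ w) [ w , γw∈δw , refl ]

  δ-antichain : ∀ {k} {x : Fin (card (suc (suc k)))} {a b : Fin (card (suc k))} →
                a ∈ δ x → b ∈ δ x → ¬ a <⁺ b
  δ-antichain {x = x} {a} a∈δx b∈δx a<⁺b with <⁺∘δ⇒δ∘<⁻ S a<⁺b b∈δx
  ... | w , a∈δw , w<⁻x with pencil-δ a w x a∈δw a∈δx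
  ...   | inj₁ refl  = strict-irrefl _ (<⁻⇒γ<⁺γ S w<⁻x)
  ...   | inj₂ w≶⁺x = disjoint w x (w≶⁺x , inj₁ w<⁻x)

  δ-≡⊎comparable⇒≡ : ∀ {k} {x : Fin (card (suc (suc k)))} {a b : Fin (card (suc k))} →
                     a ∈ δ x → b ∈ δ x → (a ≡ b) ⊎ Comparable _<⁺_ a b → a ≡ b
  δ-≡⊎comparable⇒≡ _    _    (inj₁ a≡b)         = a≡b
  δ-≡⊎comparable⇒≡ a∈δx b∈δx (inj₂ (inj₁ a<⁺b)) = ⊥-elim (δ-antichain a∈δx b∈δx a<⁺b)
  δ-≡⊎comparable⇒≡ a∈δx b∈δx (inj₂ (inj₂ b<⁺a)) = ⊥-elim (δ-antichain b∈δx a∈δx b<⁺a)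

  δ-γ-unique : ∀ {k} {x : Fin (card (suc (suc k)))} {a b : Fin (card (suc k))} {z : Fin (card k)} →
               a ∈ δ x → b ∈ δ x → γ a ≡ z → γ b ≡ z → a ≡ b
  δ-γ-unique {z = z} a∈δx b∈δx γa≡z γb≡z =
    δ-≡⊎comparable⇒≡ a∈δx b∈δx (pencil-γ z _ _ γa≡z γb≡z)

  δ-δ-unique : ∀ {k} {x : Fin (card (suc (suc k)))} {a b : Fin (card (suc k))} {z : Fin (card k)} →
               a ∈ δ x → b ∈ δ x → z ∈ δ a → z ∈ δ b → a ≡ b
  δ-δ-unique {z = z} a∈δx b∈δx z∈δa z∈δb =
    δ-≡⊎comparable⇒≡ a∈δx b∈δx (pencil-δ z _ _ z∈δa z∈δb)

  ≺-sign-unique : ∀ {y x s t} → y ≺[ s ] x → y ≺[ t ] x → s ≡ t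
  ≺-sign-unique (≺⁻ _)    (≺⁻ _)    = refl
  ≺-sign-unique (≺⁺ _)    (≺⁺ _)    = refl
  ≺-sign-unique (≺⁻ y∈δx) (≺⁺ refl) = ⊥-elim (γ∉δ _ y∈δx)
  ≺-sign-unique (≺⁺ refl) (≺⁻ y∈δx) = ⊥-elim (γ∉δ _ y∈δx)

  route-sign-unique : ∀ {z y x s t} → Route S z y x s → Route S z y x t → s ≡ t
  route-sign-unique (route z≺y y≺x refl) (route z≺′y y≺′x refl) =
    cong₂ _·_ (≺-sign-unique y≺x y≺′x) (≺-sign-unique z≺y z≺′y)

  γγ∉δδ : ∀ {k} (x : Fin (card (suc (suc k)))) → ¬ γ (γ x) ∈δδ x
  γγ∉δδ x = glob-γ x _ .proj₁ refl .proj₂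

  δγ∉γδ : ∀ {k} (x : Fin (card (suc (suc k)))) {z : Fin (card k)} → z ∈ δ (γ x) → ¬ z ∈γδ x
  δγ∉γδ x z∈δγx = glob-δ x _ .proj₁ z∈δγx .proj₂

  route-middle-unique : ∀ {z y y′ x s} → Route S z y x s → Route S z y′ x s → y ≡ y′
  route-middle-unique (route (≺⁺ refl) (≺⁺ refl) refl) (route (≺⁺ _) (≺⁺ refl) _) = refl
  route-middle-unique (route (≺⁺ refl) (≺⁺ refl) refl) (route (≺⁻ _) (≺⁺ _) ())
  route-middle-unique (route (≺⁺ refl) (≺⁺ refl) refl) (route (≺⁺ _) (≺⁻ _) ())
  route-middle-unique (route (≺⁺ refl) (≺⁺ {x = x} refl) refl) (route (≺⁻ z∈δb) (≺⁻ b∈δx) _) =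
    ⊥-elim (γγ∉δδ x (_ , b∈δx , z∈δb))
  route-middle-unique (route (≺⁻ z∈δa) (≺⁻ {x = x} a∈δx) refl) (route (≺⁺ refl) (≺⁺ refl) _) =
    ⊥-elim (γγ∉δδ x (_ , a∈δx , z∈δa))
  route-middle-unique (route (≺⁻ _) (≺⁻ _) refl) (route (≺⁻ _) (≺⁺ _) ())
  route-middle-unique (route (≺⁻ _) (≺⁻ _) refl) (route (≺⁺ _) (≺⁻ _) ())
  route-middle-unique (route (≺⁻ z∈δa) (≺⁻ a∈δx) refl) (route (≺⁻ z∈δb) (≺⁻ b∈δx) _) =
    cong (_ ,_) (δ-δ-unique a∈δx b∈δx z∈δa z∈δb)
  route-middle-unique (route (≺⁻ _) (≺⁺ refl) refl) (route (≺⁻ _) (≺⁺ refl) _) = refl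
  route-middle-unique (route (≺⁻ _) (≺⁺ refl) refl) (route (≺⁺ _) (≺⁺ _) ())
  route-middle-unique (route (≺⁻ _) (≺⁺ refl) refl) (route (≺⁻ _) (≺⁻ _) ())
  route-middle-unique (route (≺⁻ z∈δγx) (≺⁺ {x = x} refl) refl) (route (≺⁺ refl) (≺⁻ b∈δx) _) =
    ⊥-elim (δγ∉γδ x z∈δγx (_ , b∈δx , refl))
  route-middle-unique (route (≺⁺ refl) (≺⁻ a∈δx) refl) (route (≺⁻ z∈δγx) (≺⁺ {x = x} refl) _) =
    ⊥-elim (δγ∉γδ x z∈δγx (_ , a∈δx , refl))
  route-middle-unique (route (≺⁺ _) (≺⁻ _) refl) (route (≺⁺ _) (≺⁺ _) ())
  route-middle-unique (route (≺⁺ _) (≺⁻ _) refl) (route (≺⁻ _) (≺⁻ _) ())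
  route-middle-unique (route (≺⁺ refl) (≺⁻ a∈δx) refl) (route (≺⁺ z≡γb) (≺⁻ b∈δx) _) =
    cong (_ ,_) (δ-γ-unique a∈δx b∈δx refl (sym z≡γb))

  opposite-route : ∀ {z y x s} → Route S z y x s → Σ Elem λ y′ → Route S z y′ x (neg s)
  opposite-route (route (≺⁺ refl) (≺⁺ {x = x} refl) refl)
    with glob-γ x _ .proj₁ refl
  ... | (a , a∈δx , γa≡z) , _ = _ , route (≺⁺ (sym γa≡z)) (≺⁻ a∈δx) refl
  opposite-route (route (≺⁻ z∈δγx) (≺⁺ {x = x} refl) refl)
    with glob-δ x _ .proj₁ z∈δγx
  ... | (b , b∈δx , z∈δb) , _ = _ , route (≺⁻ z∈δb) (≺⁻ b∈δx) refl
  opposite-route (route (≺⁺ refl) (≺⁻ {x = x} a∈δx) refl)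
    with ∈δδ? S x _
  ... | yes (b , b∈δx , z∈δb) = _ , route (≺⁻ z∈δb) (≺⁻ b∈δx) refl
  ... | no z∉δδx = _ , route (≺⁺ (glob-γ x _ .proj₂ ((_ , a∈δx , refl) , z∉δδx))) (≺⁺ refl) refl
  opposite-route (route (≺⁻ z∈δa) (≺⁻ {x = x} a∈δx) refl)
    with ∈γδ? S x _
  ... | yes (b , b∈δx , γb≡z) = _ , route (≺⁺ (sym γb≡z)) (≺⁻ b∈δx) refl
  ... | no z∉γδx = _ , route (≺⁻ (glob-δ x _ .proj₂ ((_ , a∈δx , z∈δa) , z∉γδx))) (≺⁺ refl) refl

  orientedThin : OrientedThin
  orientedThin x y z α β z≺y y≺x with opposite-route (route z≺y y≺x refl)
  ... | y′ , r′@(route z≺y′ y′≺x _) = y′ , y′≢y , (_ , z≺y′) , (_ , y′≺x) , unique , signs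
    where
    r : Route S z y x (α · β)
    r = route z≺y y≺x refl

    y′≢y : y′ ≢ y
    y′≢y refl = s≢neg[s] (α · β) (route-sign-unique r r′)

    unique : ∀ y″ → y″ ≢ y → z ≺ y″ → y″ ≺ x → y″ ≡ y′
    unique y″ y″≢y (β″ , z≺y″) (α″ , y″≺x) with ≡⊎≡neg (α · β) (α″ · β″)
    ... | inj₁ same     = ⊥-elim (y″≢y (route-middle-unique (route z≺y″ y″≺x same) r))
    ... | inj₂ opposite = route-middle-unique (route z≺y″ y″≺x opposite) r′

    signs : ∀ α′ β′ → z ≺[ β′ ] y′ → y′ ≺[ α′ ] x → α · β ≡ neg (α′ · β′)
    signs α′ β′ z≺′y′ y′≺′x = trans (sym (neg-involutive (α · β)))
      (cong neg (route-sign-unique r′ (route z≺′y′ y′≺′x refl)))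

mainTheorem12 : (S : PosHypergraph) → IsOpetopicCardinal S → PosetOf.OrientedThin S
mainTheorem12 S O = OpetopicCardinal.orientedThin O
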